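{- Let $F$ be an $n$-vertex forest with maximum degree at most $d$, and let $\rho \geq 1/n$. Then there is a set of fewer than $d/\rho$ edges of $F$ whose deletion yields a forest in which each component tree has at most $\rho n$ vertices. -}

module Defs where

open import Data.Nat using (ℕ; _≤_)
open import Data.Fin using (Fin)
open import Data.Fin.Properties using (_≟_)
open import Data.Integer using (+_)
open import Data.Rational using (ℚ; _/_)
open import Data.Product using (_×_; _,_; proj₁; proj₂; Σ)
open import Data.Sum using (_⊎_)
open import Data.List using (List; []; _∷_; _++_; [_]; length; filter)
open import Data.List.Membership.Propositional using (_∈_)
open import Data.List.Relation.Unary.All using (All)
open import Data.List.Relation.Unary.AllPairs using (AllPairs)
open import Data.List.Relation.Unary.Unique.Propositional using (Unique)
open import Data.List.Relation.Unary.Linked using (Linked)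
open import Relation.Binary.PropositionalEquality using (_≡_; _≢_)
open import Relation.Binary.Construct.Closure.ReflexiveTransitive using (Star)
open import Relation.Nullary using (¬_)
open import Relation.Nullary.Decidable using (_⊎-dec_)

toℚ : ℕ → ℚ
toℚ k = (+ k) / 1

-- A graph on vertex set Fin n, given by its list of edges {u,v} (written as pairs).
Edge : ℕ → Set
Edge n = Fin n × Fin n

SameEdge : ∀ {n} → Edge n → Edge n → Set
SameEdge (a , b) (c , d) = (a ≡ c × b ≡ d) ⊎ (a ≡ d × b ≡ c)

IsSimple : ∀ {n} → List (Edge n) → Set
IsSimple E = All (λ e → proj₁ e ≢ proj₂ e) E × AllPairs (λ e f → ¬ SameEdge e f) E

Adj : ∀ {n} → List (Edge n) → Fin n → Fin n → Set
Adj E u v = (u , v) ∈ E ⊎ (v , u) ∈ E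

degree : ∀ {n} → List (Edge n) → Fin n → ℕ
degree E v = length (filter (λ e → (proj₁ e ≟ v) ⊎-dec (proj₂ e ≟ v)) E)

record Cycle {n} (E : List (Edge n)) : Set where
  field
    start    : Fin n
    rest     : List (Fin n)
    long     : 2 ≤ length rest
    distinct : Unique (start ∷ rest)
    closed   : Linked (Adj E) (start ∷ rest ++ [ start ])

IsForest : ∀ {n} → List (Edge n) → Set
IsForest E = IsSimple E × ¬ Cycle E

Reachable : ∀ {n} → List (Edge n) → Fin n → Fin n → Set
Reachable E = Star (Adj E)

-- every connected component has at most m vertices, where m : ℚ;
-- i.e. every list of distinct vertices in the component of v has length ≤ m
ComponentsAtMost : ∀ {n} → List (Edge n) → ℚ → Set
ComponentsAtMost {n} E m =
  ∀ (v : Fin n) (us : List (Fin n)) → Unique us → All (Reachable E v) us →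
  Data.Rational._≤_ (toℚ (length us)) m

-- Root every tree of the forest and sweep it bottom-up with k = ⌊ρn⌋, keeping at each vertex v an
-- active cluster containing v. If v and the active clusters of its children have at most k vertices
-- in total, they merge; otherwise those clusters are closed and the c edges from v to its children
-- are cut. A cut therefore closes clusters of total size at least k, each of at least one vertex,
-- and c ≤ d − 1 below the root (c ≤ d at the root). Hence the potential |S|(k+1) + d·|active
-- cluster| of a subtree stays at most d times its number of vertices, so |S|(k+1) ≤ dn, that is
-- |S|ρ < d, while every component of the remaining forest lies in one cluster of at most k ≤ ρn
-- vertices.
module Submission where

open import Defs

-- A separate scope, since its ℕ operators would clash with the rational _/_, _*_ and _<_ of the statement.
module ForestClustering where

  open import Data.Nat using (ℕ; zero; suc; _+_; _*_; _≤_; _<_; z≤n; s≤s; _≤?_; NonZero)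
  open import Data.Nat.Properties hiding (_≟_)
  open import Data.Nat.DivMod using (_/_; m≡m%n+[m/n]*n; m%n<n; m/n*n≤m; m≥n⇒m/n>0)
  open import Data.Nat.Coprimality using (Coprime)
  open import Data.Nat.Tactic.RingSolver using (solve-∀)
  open import Data.Integer using (-[1+_]; +≤+; +<+)
  import Data.Integer as ℤ
  import Data.Integer.Properties as ℤ
  open import Data.Rational using (ℚ; mkℚ; toℚᵘ) renaming (_/_ to _/ℚ_)
  import Data.Rational as ℚ
  import Data.Rational.Properties as ℚ
  open import Data.Rational.Unnormalised using (mkℚᵘ; *≤*; *<*)
  import Data.Rational.Unnormalised as ℚᵘ
  import Data.Rational.Unnormalised.Properties as ℚᵘ
  open import Data.Fin using (Fin)
  open import Data.Fin.Properties using (_≟_; any?)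
  open import Data.Bool using (Bool; true; false)
  open import Data.Product using (∃; _×_; _,_; proj₁)
  open import Data.Product.Properties using (≡-dec)
  open import Data.Sum using (_⊎_; inj₁; inj₂)
  open import Data.Empty using (⊥-elim)
  open import Function using (_∘_)
  open import Data.List using (List; []; _∷_; _++_; [_]; length; concat; concatMap; map; allFin)
  open import Data.List.Properties
    using (filter-accept; filter-reject; filter-none; length-++; length-tabulate; concat-++; ++-assoc)
  open import Data.List.Membership.Propositional using (_∈_; _∉_)
  open import Data.List.Membership.Propositional.Properties
    using (∈-allFin; ∈-++⁺ˡ; ∈-++⁻; ∈-∃++; ∈-filter⁺; ∈-length; ∈-concat⁺′; ∈-concat⁻′; ∈-concatMap⁻; ∈-map⁻)
  open import Data.List.Membership.DecPropositional using () renaming (_∈?_ to member?)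
  open import Data.List.Relation.Unary.Any using (Any; here; there)
  import Data.List.Relation.Unary.Any.Properties as Anyₚ
  open import Data.List.Relation.Unary.All as All using (All; []; _∷_)
  import Data.List.Relation.Unary.All.Properties as Allₚ
  open import Data.List.Relation.Unary.AllPairs using (AllPairs; []; _∷_)
  open import Data.List.Relation.Unary.Unique.Propositional using (Unique)
  open import Data.List.Relation.Unary.Unique.Propositional.Properties using (allFin⁺)
  open import Data.List.Relation.Unary.Linked as Linked using (Linked; [-]; _∷_)
  open import Data.List.Relation.Binary.Subset.Propositional using (_⊆_)
  open import Data.List.Relation.Binary.Subset.Propositional.Properties
    using (xs⊆xs++ys; xs⊆ys++xs; xs⊆x∷xs; ⊆-trans; ∷⁺ʳ; ⊆-reflexive-↭)
  open import Data.List.Relation.Binary.Permutation.Propositional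
    using (_↭_; ↭-refl; ↭-prep; ↭-swap; ↭-sym; ↭-trans; ↭-reflexive; ↭⇒↭ₛ; module PermutationReasoning)
  open import Data.List.Relation.Binary.Permutation.Propositional.Properties
    using (All-resp-↭; ∈-resp-↭; ↭-length; filter-↭; shift; shifts; ++⁺ˡ; ++⁺ʳ) renaming (++⁺ to ↭-++⁺)
  import Data.List.Relation.Binary.Permutation.Setoid.Properties as ↭ₛ
  open import Relation.Binary.Construct.Closure.ReflexiveTransitive using (ε; _◅_)
  open import Relation.Binary.PropositionalEquality
    using (_≡_; _≢_; refl; sym; trans; cong; cong₂; subst; subst₂; setoid; resp₂)
  open import Relation.Nullary using (¬_; Dec; yes; no; ¬?)
  open import Relation.Nullary.Decidable using (_×-dec_; _⊎-dec_; decidable-stable)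

  -- Lists

  module _ {A : Set} where

    Unique-resp-↭ : ∀ {xs ys : List A} → xs ↭ ys → Unique xs → Unique ys
    Unique-resp-↭ p = ↭ₛ.Unique-resp-↭ (setoid A) (↭⇒↭ₛ p)

    AllPairs-resp-↭ : ∀ {R : A → A → Set} → (∀ {x y} → R x y → R y x) →
                      ∀ {xs ys} → xs ↭ ys → AllPairs R xs → AllPairs R ys
    AllPairs-resp-↭ {R} R-sym p = ↭ₛ.AllPairs-resp-↭ (setoid A) R-sym (resp₂ R) (↭⇒↭ₛ p)

    Unique⇒length≤ : ∀ {us ws : List A} → Unique us → All (_∈ ws) us → length us ≤ length ws
    Unique⇒length≤ {[]} _ _ = z≤n
    Unique⇒length≤ {u ∷ us} (u∉us ∷ uniq) (u∈ws ∷ us⊆ws) with ∈-∃++ u∈ws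
    ... | pre , post , refl = begin
      suc (length us)               ≤⟨ s≤s (Unique⇒length≤ uniq (All.zipWith drop-u (u∉us , us⊆ws))) ⟩
      suc (length (pre ++ post))    ≡⟨ ↭-length (shift u pre post) ⟨
      length (pre ++ [ u ] ++ post) ∎
      where
      open ≤-Reasoning
      drop-u : ∀ {v} → u ≢ v × v ∈ pre ++ [ u ] ++ post → v ∈ pre ++ post
      drop-u (u≢v , v∈) with ∈-resp-↭ (shift u pre post) v∈
      ... | here v≡u = ⊥-elim (u≢v (sym v≡u))
      ... | there v∈′ = v∈′

    Unique-++⁻ˡ : ∀ xs {ys : List A} → Unique (xs ++ ys) → Unique xs
    Unique-++⁻ˡ [] _ = []
    Unique-++⁻ˡ (x ∷ xs) (x∉ ∷ uniq) = Allₚ.++⁻ˡ xs x∉ ∷ Unique-++⁻ˡ xs uniq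

    Unique-++⁻ʳ : ∀ xs {ys : List A} → Unique (xs ++ ys) → Unique ys
    Unique-++⁻ʳ [] uniq = uniq
    Unique-++⁻ʳ (x ∷ xs) (_ ∷ uniq) = Unique-++⁻ʳ xs uniq

    Unique-mid : ∀ xs {z} {ys : List A} → Unique (xs ++ z ∷ ys) → Unique (z ∷ xs)
    Unique-mid xs {z} {ys} uniq = Unique-++⁻ˡ (z ∷ xs) (Unique-resp-↭ (shift z xs ys) uniq)

    Linked-prefix : ∀ {R : A → A → Set} xs {y ys} → Linked R (xs ++ y ∷ ys) → Linked R (xs ++ [ y ])
    Linked-prefix [] _ = [-]
    Linked-prefix (x ∷ []) (r ∷ _) = r ∷ [-]
    Linked-prefix (x ∷ x′ ∷ xs) (r ∷ rs) = r ∷ Linked-prefix (x′ ∷ xs) rs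

    Unique-++⇒∉ : ∀ xs {ys : List A} {x} → Unique (xs ++ ys) → x ∈ xs → x ∉ ys
    Unique-++⇒∉ (x ∷ xs) (x∉ ∷ _) (here refl) x∈ys = All.lookup (Allₚ.++⁻ʳ xs x∉) x∈ys refl
    Unique-++⇒∉ (x ∷ xs) (_ ∷ uniq) (there x∈xs) = Unique-++⇒∉ xs uniq x∈xs

    Unique-concat-overlap⇒≡ : ∀ (xss : List (List A)) {xs ys x} → Unique (concat xss) →
                          xs ∈ xss → ys ∈ xss → x ∈ xs → x ∈ ys → xs ≡ ys
    Unique-concat-overlap⇒≡ (zs ∷ xss) uniq (here refl) (here refl) _ _ = refl
    Unique-concat-overlap⇒≡ (zs ∷ xss) uniq (here refl) (there ys∈) x∈xs x∈ys =
      ⊥-elim (Unique-++⇒∉ zs uniq x∈xs (∈-concat⁺′ x∈ys ys∈))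
    Unique-concat-overlap⇒≡ (zs ∷ xss) uniq (there xs∈) (here refl) x∈xs x∈ys =
      ⊥-elim (Unique-++⇒∉ zs uniq x∈ys (∈-concat⁺′ x∈xs xs∈))
    Unique-concat-overlap⇒≡ (zs ∷ xss) uniq (there xs∈) (there ys∈) =
      Unique-concat-overlap⇒≡ xss (Unique-++⁻ʳ zs uniq) xs∈ ys∈

  ∈-∷⁻ : ∀ {A : Set} {x y : A} {xs} → x ∈ y ∷ xs → x ≢ y → x ∈ xs
  ∈-∷⁻ (here x≡y) x≢y = ⊥-elim (x≢y x≡y)
  ∈-∷⁻ (there x∈xs) _ = x∈xs

  Any⇒↭∷ : ∀ {A : Set} {P : A → Set} {xs} → Any P xs → ∃ λ y → ∃ λ ys → (xs ↭ y ∷ ys) × P y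
  Any⇒↭∷ {xs = x ∷ xs} (here px) = x , xs , ↭-refl , px
  Any⇒↭∷ {xs = x ∷ xs} (there any) with Any⇒↭∷ any
  ... | y , ys , p , py = y , x ∷ ys , ↭-trans (↭-prep x p) (↭-swap x y ↭-refl) , py

  concatMap-↭ : ∀ {A B : Set} (f : A → List B) {xs ys} → xs ↭ ys → concatMap f xs ↭ concatMap f ys
  concatMap-↭ f _↭_.refl = ↭-refl
  concatMap-↭ f (_↭_.prep x p) = ++⁺ˡ (f x) (concatMap-↭ f p)
  concatMap-↭ f (_↭_.swap x y p) = ↭-trans (shifts (f x) (f y)) (++⁺ˡ (f y) (++⁺ˡ (f x) (concatMap-↭ f p)))
  concatMap-↭ f (_↭_.trans p q) = ↭-trans (concatMap-↭ f p) (concatMap-↭ f q)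

  ++-interchange : ∀ {A : Set} (a b c d : List A) → (a ++ b) ++ (c ++ d) ↭ (a ++ c) ++ (b ++ d)
  ++-interchange a b c d = begin
    (a ++ b) ++ (c ++ d) ≡⟨ ++-assoc a b (c ++ d) ⟩
    a ++ (b ++ c ++ d)   ↭⟨ ++⁺ˡ a (shifts b c) ⟩
    a ++ (c ++ b ++ d)   ≡⟨ ++-assoc a c (b ++ d) ⟨
    (a ++ c) ++ (b ++ d) ∎
    where open PermutationReasoning

  length≤length-concat : ∀ {A : Set} (xss : List (List A)) → All (λ xs → 1 ≤ length xs) xss →
                         length xss ≤ length (concat xss)
  length≤length-concat [] [] = z≤n
  length≤length-concat (xs ∷ xss) (1≤ ∷ 1≤s) =
    ≤-trans (+-mono-≤ 1≤ (length≤length-concat xss 1≤s)) (≤-reflexive (sym (length-++ xs)))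

  -- Degrees, leaves and cycles

  module _ {n : ℕ} where

    Incident : Fin n → Edge n → Set
    Incident v (a , b) = a ≡ v ⊎ b ≡ v

    incident? : ∀ v e → Dec (Incident v e)
    incident? v (a , b) = (a ≟ v) ⊎-dec (b ≟ v)

    degree-incident : ∀ {v e} E → Incident v e → degree (e ∷ E) v ≡ suc (degree E v)
    degree-incident {v} E i = cong length (filter-accept (incident? v) i)

    degree-¬incident : ∀ {v e} E → ¬ Incident v e → degree (e ∷ E) v ≡ degree E v
    degree-¬incident {v} E ¬i = cong length (filter-reject (incident? v) ¬i)

    degree-↭ : ∀ {E E′} v → E ↭ E′ → degree E v ≡ degree E′ v
    degree-↭ v p = ↭-length (filter-↭ (incident? v) p)

    degree>0 : ∀ {v e E} → e ∈ E → Incident v e → 0 < degree E v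
    degree>0 {v} e∈E i = ∈-length (∈-filter⁺ (incident? v) e∈E i)

    degree≡0 : ∀ {v} E → All (¬_ ∘ Incident v) E → degree E v ≡ 0
    degree≡0 {v} E ¬is = cong length (filter-none (incident? v) ¬is)

    degree-∷ : ∀ e (E : List (Edge n)) v → degree E v ≤ degree (e ∷ E) v
    degree-∷ e E v with incident? v e
    ... | yes i = ≤-trans (n≤1+n _) (≤-reflexive (sym (degree-incident E i)))
    ... | no ¬i = ≤-reflexive (sym (degree-¬incident E ¬i))

    degree-↭∷-mono : ∀ {E e} {E′ : List (Edge n)} → E ↭ e ∷ E′ → ∀ v → degree E′ v ≤ degree E v
    degree-↭∷-mono {e = e} {E′} E↭ v = ≤-trans (degree-∷ e E′ v) (≤-reflexive (sym (degree-↭ v E↭)))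

    degree-↭∷-incident : ∀ {E e} {E′ : List (Edge n)} {v} → E ↭ e ∷ E′ → Incident v e →
                         degree E v ≡ suc (degree E′ v)
    degree-↭∷-incident {E′ = E′} {v} E↭ i = trans (degree-↭ v E↭) (degree-incident E′ i)

    degree≡0⇒isolated : ∀ {v} {E : List (Edge n)} → degree E v ≡ 0 → All (¬_ ∘ Incident v) E
    degree≡0⇒isolated deg = All.tabulate λ e∈E i → <⇒≢ (degree>0 e∈E i) (sym deg)

    Unique⇒length≤n : ∀ {us : List (Fin n)} → Unique us → length us ≤ n
    Unique⇒length≤n {us} uniq = begin
      length us         ≤⟨ Unique⇒length≤ uniq (All.tabulate (λ {u} _ → ∈-allFin u)) ⟩
      length (allFin n) ≡⟨ length-tabulate (λ i → i) ⟩
      n                 ∎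
      where open ≤-Reasoning

    Adj-sym : ∀ {E : List (Edge n)} {u v} → Adj E u v → Adj E v u
    Adj-sym (inj₁ uv∈E) = inj₂ uv∈E
    Adj-sym (inj₂ vu∈E) = inj₁ vu∈E

    Adj-mono : ∀ {E E′ : List (Edge n)} → (∀ {e} → e ∈ E → e ∈ E′) → ∀ {u v} → Adj E u v → Adj E′ u v
    Adj-mono E⊆E′ (inj₁ uv∈E) = inj₁ (E⊆E′ uv∈E)
    Adj-mono E⊆E′ (inj₂ vu∈E) = inj₂ (E⊆E′ vu∈E)

    adj? : ∀ E (u v : Fin n) → Dec (Adj E u v)
    adj? E u v = member? (≡-dec _≟_ _≟_) (u , v) E ⊎-dec member? (≡-dec _≟_ _≟_) (v , u) E

    Adj⇒degree>0 : ∀ {E u v} → Adj E u v → 0 < degree E u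
    Adj⇒degree>0 (inj₁ uv∈E) = degree>0 uv∈E (inj₁ refl)
    Adj⇒degree>0 (inj₂ vu∈E) = degree>0 vu∈E (inj₂ refl)

    SameEdge-sym : ∀ {e f : Edge n} → SameEdge e f → SameEdge f e
    SameEdge-sym (inj₁ (a≡c , b≡d)) = inj₁ (sym a≡c , sym b≡d)
    SameEdge-sym (inj₂ (a≡d , b≡c)) = inj₂ (sym b≡c , sym a≡d)

    Adj-loopless : ∀ {E : List (Edge n)} → IsSimple E → ∀ {u} → ¬ Adj E u u
    Adj-loopless (loopless , _) (inj₁ uu∈E) = All.lookup loopless uu∈E refl
    Adj-loopless (loopless , _) (inj₂ uu∈E) = All.lookup loopless uu∈E refl

    Cycle-mono : ∀ {E E′ : List (Edge n)} → (∀ {e} → e ∈ E → e ∈ E′) → Cycle E → Cycle E′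
    Cycle-mono E⊆E′ c = record
      { start = start ; rest = rest ; long = long ; distinct = distinct
      ; closed = Linked.map (Adj-mono E⊆E′) closed }
      where open Cycle c

    IsForest-resp-↭ : ∀ {E E′ : List (Edge n)} → E ↭ E′ → IsForest E → IsForest E′
    IsForest-resp-↭ p ((loopless , distinct) , acyclic) =
      (All-resp-↭ p loopless , AllPairs-resp-↭ (_∘ SameEdge-sym) p distinct) ,
      acyclic ∘ Cycle-mono (∈-resp-↭ (↭-sym p))

    IsForest-∷⁻ : ∀ {e} {E : List (Edge n)} → IsForest (e ∷ E) → IsForest E
    IsForest-∷⁻ ((_ ∷ loopless , _ ∷ distinct) , acyclic) = (loopless , distinct) , acyclic ∘ Cycle-mono there

    unique-neighbour⇒SameEdge : ∀ {E x y e f} → (∀ {z} → Adj E x z → z ≡ y) →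
                                e ∈ E → f ∈ E → Incident x e → Incident x f → SameEdge e f
    unique-neighbour⇒SameEdge nb e∈ f∈ (inj₁ refl) (inj₁ refl) =
      inj₁ (refl , trans (nb (inj₁ e∈)) (sym (nb (inj₁ f∈))))
    unique-neighbour⇒SameEdge nb e∈ f∈ (inj₁ refl) (inj₂ refl) =
      inj₂ (refl , trans (nb (inj₁ e∈)) (sym (nb (inj₂ f∈))))
    unique-neighbour⇒SameEdge nb e∈ f∈ (inj₂ refl) (inj₁ refl) =
      inj₂ (trans (nb (inj₂ e∈)) (sym (nb (inj₁ f∈))) , refl)
    unique-neighbour⇒SameEdge nb e∈ f∈ (inj₂ refl) (inj₂ refl) =
      inj₁ (trans (nb (inj₂ e∈)) (sym (nb (inj₂ f∈))) , refl)

    unique-neighbour⇒degree≤1 : ∀ {x y} E → IsSimple E → (∀ {z} → Adj E x z → z ≡ y) → degree E x ≤ 1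
    unique-neighbour⇒degree≤1 [] _ _ = z≤n
    unique-neighbour⇒degree≤1 {x} (e ∷ E) (_ ∷ loopless , e≁ ∷ distinct) nb with incident? x e
    ... | no ¬i = ≤-trans (≤-reflexive (degree-¬incident E ¬i))
                          (unique-neighbour⇒degree≤1 E (loopless , distinct) (nb ∘ Adj-mono there))
    ... | yes i = ≤-reflexive (trans (degree-incident E i) (cong suc (degree≡0 E (All.tabulate ¬incident))))
      where
      ¬incident : ∀ {f} → f ∈ E → ¬ Incident x f
      ¬incident f∈E i′ = All.lookup e≁ f∈E (unique-neighbour⇒SameEdge nb (here refl) (there f∈E) i i′)

    module _ (E : List (Edge n)) (simple : IsSimple E) (no-leaf : ∀ v → degree E v ≢ 1) where

      another-neighbour : ∀ {x y} → Adj E x y → ∃ λ z → Adj E x z × z ≢ y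
      another-neighbour {x} {y} x~y with any? (λ z → adj? E x z ×-dec ¬? (z ≟ y))
      ... | yes found = found
      ... | no none =
        ⊥-elim (no-leaf x (≤-antisym (unique-neighbour⇒degree≤1 E simple only-y) (Adj⇒degree>0 x~y)))
        where
        only-y : ∀ {z} → Adj E x z → z ≡ y
        only-y {z} x~z = decidable-stable (z ≟ y) (λ z≢y → none (z , x~z , z≢y))

      -- The path is kept in reverse, most recent vertex first; the fuel bounds its length by pigeonhole.
      extend-to-cycle : ∀ fuel x y ws → n < length (x ∷ y ∷ ws) + fuel →
                        Unique (x ∷ y ∷ ws) → Linked (Adj E) (x ∷ y ∷ ws) → Cycle E
      extend-to-cycle zero x y ws bound uniq _ =
        ⊥-elim (<⇒≱ (subst (n <_) (+-identityʳ _) bound) (Unique⇒length≤n uniq))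
      extend-to-cycle (suc fuel) x y ws bound uniq (x~y ∷ path) with another-neighbour x~y
      ... | z , x~z , z≢y with member? _≟_ z (x ∷ y ∷ ws)
      ...   | no z∉ = extend-to-cycle fuel z x (y ∷ ws) (subst (n <_) (+-suc _ fuel) bound)
                        (Allₚ.¬Any⇒All¬ _ z∉ ∷ uniq) (Adj-sym x~z ∷ x~y ∷ path)
      ...   | yes z∈ with ∈-∃++ z∈
      ...     | [] , _ , refl = ⊥-elim (Adj-loopless simple x~z)
      ...     | _ ∷ [] , _ , refl = ⊥-elim (z≢y refl)
      ...     | x ∷ y ∷ pre , _ , refl = record
        { start = z ; rest = x ∷ y ∷ pre ; long = s≤s (s≤s z≤n)
        ; distinct = Unique-mid (x ∷ y ∷ pre) uniq
        ; closed = Adj-sym x~z ∷ Linked-prefix (x ∷ y ∷ pre) (x~y ∷ path) }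

    forest⇒leaf : ∀ (E : List (Edge n)) → IsForest E → ∀ {e} → e ∈ E → ∃ λ v → degree E v ≡ 1
    forest⇒leaf E (simple , acyclic) {a , b} ab∈E with any? (λ v → degree E v Data.Nat.≟ 1)
    ... | yes leaf = leaf
    ... | no none = ⊥-elim (acyclic (extend-to-cycle E simple (λ v d≡1 → none (v , d≡1)) n b a []
                      (s≤s (n≤1+n n)) ((b≢a ∷ []) ∷ [] ∷ []) (inj₂ ab∈E ∷ [-])))
      where
      b≢a : b ≢ a
      b≢a b≡a = All.lookup (proj₁ simple) ab∈E (sym b≡a)

    extract-incident : ∀ {v m} (E : List (Edge n)) → degree E v ≡ suc m →
      ∃ λ e → ∃ λ E′ → (E ↭ e ∷ E′) × Incident v e × degree E′ v ≡ m
    extract-incident {v} (f ∷ E) deg with incident? v f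
    ... | yes i = f , E , ↭-refl , i , suc-injective (trans (sym (degree-incident E i)) deg)
    ... | no ¬i with extract-incident E (trans (sym (degree-¬incident E ¬i)) deg)
    ...   | e , E′ , p , i , deg′ = e , f ∷ E′ , ↭-trans (↭-prep f p) (↭-swap f e ↭-refl) , i ,
                                     trans (degree-¬incident E′ ¬i) deg′

  -- Rooted decompositions of a forest

  -- The flag on each branch records in which orientation its edge is listed.
  data Tree (n : ℕ) : Set where
    node : Fin n → List (Bool × Tree n) → Tree n

  Branches : ℕ → Set
  Branches n = List (Bool × Tree n)

  module _ {n : ℕ} where

    root : Tree n → Fin n
    root (node v _) = v

    link : Bool → Fin n → Fin n → Edge n
    link false parent child = parent , child
    link true parent child = child , parent

    link-incidentˡ : ∀ b {p c} → Incident p (link b p c)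
    link-incidentˡ false = inj₁ refl
    link-incidentˡ true = inj₂ refl

    link-incidentʳ : ∀ b {p c} → Incident c (link b p c)
    link-incidentʳ false = inj₂ refl
    link-incidentʳ true = inj₁ refl

    mutual
      vertices : Tree n → List (Fin n)
      vertices (node v bs) = v ∷ vertices* bs

      vertices* : Branches n → List (Fin n)
      vertices* [] = []
      vertices* ((_ , t) ∷ bs) = vertices t ++ vertices* bs

    mutual
      edges : Tree n → List (Edge n)
      edges (node v bs) = edges* v bs

      edges* : Fin n → Branches n → List (Edge n)
      edges* v [] = []
      edges* v ((b , t) ∷ bs) = link b v (root t) ∷ edges t ++ edges* v bs

    -- The index h is 1 for a tree hanging below a parent: its edge to the parent counts towards
    -- the degree of its root.
    mutual
      data DegreeBounded (D : Fin n → ℕ) : ℕ → Tree n → Set where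
        node : ∀ {h v bs} → length bs + h ≤ D v → DegreeBounded* D bs → DegreeBounded D h (node v bs)

      data DegreeBounded* (D : Fin n → ℕ) : Branches n → Set where
        [] : DegreeBounded* D []
        _∷_ : ∀ {b t bs} → DegreeBounded D 1 t → DegreeBounded* D bs → DegreeBounded* D ((b , t) ∷ bs)

    mutual
      DegreeBounded-mono : ∀ {D D′ h t} → (∀ v → D v ≤ D′ v) → DegreeBounded D h t → DegreeBounded D′ h t
      DegreeBounded-mono D≤D′ (node {v = v} deg bs) = node (≤-trans deg (D≤D′ v)) (DegreeBounded*-mono D≤D′ bs)

      DegreeBounded*-mono : ∀ {D D′ bs} → (∀ v → D v ≤ D′ v) → DegreeBounded* D bs → DegreeBounded* D′ bs
      DegreeBounded*-mono D≤D′ [] = []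
      DegreeBounded*-mono D≤D′ (t ∷ bs) = DegreeBounded-mono D≤D′ t ∷ DegreeBounded*-mono D≤D′ bs

    mutual
      ∈-vertices⇒root⊎incident : ∀ {ℓ} t → ℓ ∈ vertices t → ℓ ≡ root t ⊎ Any (Incident ℓ) (edges t)
      ∈-vertices⇒root⊎incident (node v bs) (here ℓ≡v) = inj₁ ℓ≡v
      ∈-vertices⇒root⊎incident (node v bs) (there ℓ∈) = inj₂ (∈-vertices*⇒incident v bs ℓ∈)

      ∈-vertices*⇒incident : ∀ {ℓ} v bs → ℓ ∈ vertices* bs → Any (Incident ℓ) (edges* v bs)
      ∈-vertices*⇒incident v ((b , t) ∷ bs) ℓ∈ with ∈-++⁻ (vertices t) ℓ∈
      ... | inj₂ ℓ∈bs = there (Anyₚ.++⁺ʳ (edges t) (∈-vertices*⇒incident v bs ℓ∈bs))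
      ... | inj₁ ℓ∈t with ∈-vertices⇒root⊎incident t ℓ∈t
      ...   | inj₁ refl = here (link-incidentʳ b)
      ...   | inj₂ incident = there (Anyₚ.++⁺ˡ incident)

    isolated⇒singleton : ∀ {ℓ} Ts → ℓ ∈ concatMap vertices Ts → All (¬_ ∘ Incident ℓ) (concatMap edges Ts) →
                         ∃ λ Ts′ → Ts ↭ node ℓ [] ∷ Ts′
    isolated⇒singleton (t ∷ Ts) ℓ∈ isolated with ∈-++⁻ (vertices t) ℓ∈ | Allₚ.++⁻ (edges t) isolated
    ... | inj₂ ℓ∈Ts | _ , isolated-Ts with isolated⇒singleton Ts ℓ∈Ts isolated-Ts
    ...   | Ts′ , p = t ∷ Ts′ , ↭-trans (↭-prep t p) (↭-swap t _ ↭-refl)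
    isolated⇒singleton (t ∷ Ts) ℓ∈ isolated | inj₁ ℓ∈t | isolated-t , _ with ∈-vertices⇒root⊎incident t ℓ∈t
    ... | inj₂ incident = ⊥-elim (Allₚ.All¬⇒¬Any isolated-t incident)
    isolated⇒singleton (node _ [] ∷ Ts) _ _ | inj₁ _ | _ | inj₁ refl = Ts , ↭-refl
    isolated⇒singleton (node _ ((b , _) ∷ _) ∷ Ts) _ _ | inj₁ _ | isolated-t , _ | inj₁ refl =
      ⊥-elim (All.head isolated-t (link-incidentˡ b))

  module Graft {n} (D D′ : Fin n → ℕ) (D≤D′ : ∀ v → D v ≤ D′ v) (b : Bool) (p ℓ : Fin n)
               (room-p : suc (D p) ≤ D′ p) (room-ℓ : 1 ≤ D′ ℓ) where

    record Grafted (h : ℕ) (t : Tree n) : Set where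
      constructor grafted
      field
        tree       : Tree n
        same-root  : root tree ≡ root t
        vertices-↭ : vertices tree ↭ ℓ ∷ vertices t
        edges-↭    : edges tree ↭ link b p ℓ ∷ edges t
        bounded    : DegreeBounded D′ h tree

    record Grafted* (v : Fin n) (bs : Branches n) : Set where
      constructor grafted*
      field
        branches    : Branches n
        same-length : length branches ≡ length bs
        vertices-↭  : vertices* branches ↭ ℓ ∷ vertices* bs
        edges-↭     : edges* v branches ↭ link b p ℓ ∷ edges* v bs
        bounded     : DegreeBounded* D′ branches

    mutual
      graft : ∀ {h} t → p ∈ vertices t → DegreeBounded D h t → Grafted h t
      graft (node v bs) (here refl) (node deg bs-bounded) =
        grafted (node v ((b , node ℓ []) ∷ bs)) refl (↭-swap v ℓ ↭-refl) ↭-refl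
                (node (≤-trans (s≤s deg) room-p) (node room-ℓ [] ∷ DegreeBounded*-mono D≤D′ bs-bounded))
      graft {h} (node v bs) (there p∈) (node deg bs-bounded) with graft* v bs p∈ bs-bounded
      ... | grafted* bs′ len vs es bounded =
        grafted (node v bs′) refl (↭-trans (↭-prep v vs) (↭-swap v ℓ ↭-refl)) es
                (node (subst (λ k → k + h ≤ D′ v) (sym len) (≤-trans deg (D≤D′ v))) bounded)

      graft* : ∀ v bs → p ∈ vertices* bs → DegreeBounded* D bs → Grafted* v bs
      graft* v ((b′ , t) ∷ bs) p∈ (t-bounded ∷ bs-bounded) with ∈-++⁻ (vertices t) p∈
      ... | inj₁ p∈t with graft t p∈t t-bounded
      ...   | grafted t′ same-root vs es bounded =
        grafted* ((b′ , t′) ∷ bs) refl (++⁺ʳ (vertices* bs) vs)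
                 (↭-trans (↭-prep _ (++⁺ʳ (edges* v bs) es))
                   (↭-trans (↭-swap _ _ ↭-refl)
                     (↭-prep _ (↭-reflexive (cong (λ r → link b′ v r ∷ edges t ++ edges* v bs) same-root)))))
                 (bounded ∷ DegreeBounded*-mono D≤D′ bs-bounded)
      graft* v ((b′ , t) ∷ bs) p∈ (t-bounded ∷ bs-bounded) | inj₂ p∈bs with graft* v bs p∈bs bs-bounded
      ... | grafted* bs′ len vs es bounded =
        grafted* ((b′ , t) ∷ bs′) (cong suc len)
                 (↭-trans (++⁺ˡ (vertices t) vs) (shift ℓ (vertices t) (vertices* bs)))
                 (↭-trans (↭-prep _ (↭-trans (++⁺ˡ (edges t) es) (shift _ (edges t) (edges* v bs))))
                   (↭-swap _ _ ↭-refl))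
                 (DegreeBounded-mono D≤D′ t-bounded ∷ bounded)

    graft-forest : ∀ Ts → p ∈ concatMap vertices Ts → All (DegreeBounded D 0) Ts →
      ∃ λ Ts′ → (concatMap vertices Ts′ ↭ ℓ ∷ concatMap vertices Ts)
              × (concatMap edges Ts′ ↭ link b p ℓ ∷ concatMap edges Ts)
              × All (DegreeBounded D′ 0) Ts′
    graft-forest Ts p∈ bounded with Any⇒↭∷ (∈-concatMap⁻ vertices {xs = Ts} p∈)
    ... | t , Ts₀ , Ts↭ , p∈t with All-resp-↭ Ts↭ bounded
    ...   | t-bounded ∷ Ts₀-bounded with graft t p∈t t-bounded
    ...     | grafted t′ _ vs es t′-bounded =
      t′ ∷ Ts₀ ,
      ↭-trans (++⁺ʳ _ vs) (↭-prep ℓ (↭-sym (concatMap-↭ vertices Ts↭))) ,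
      ↭-trans (++⁺ʳ _ es) (↭-prep _ (↭-sym (concatMap-↭ edges Ts↭))) ,
      t′-bounded ∷ All.map (DegreeBounded-mono D≤D′) Ts₀-bounded

  module _ {n : ℕ} where

    link∈⇒endpoints-distinct : ∀ b {F : List (Edge n)} {p c} → IsSimple F → link b p c ∈ F → p ≢ c
    link∈⇒endpoints-distinct false (loopless , _) e∈F = All.lookup loopless e∈F
    link∈⇒endpoints-distinct true (loopless , _) e∈F = All.lookup loopless e∈F ∘ sym

    incident⇒link : ∀ {ℓ} (e : Edge n) → Incident ℓ e → ∃ λ p → ∃ λ b → link b p ℓ ≡ e
    incident⇒link (a , c) (inj₁ refl) = c , true , refl
    incident⇒link (a , c) (inj₂ refl) = a , false , refl

    record RootedDecomposition (F : List (Edge n)) : Set where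
      constructor decomposition
      field
        trees   : List (Tree n)
        spans   : concatMap vertices trees ↭ allFin n
        covers  : concatMap edges trees ↭ F
        bounded : All (DegreeBounded (degree F) 0) trees

    singletons : RootedDecomposition []
    singletons = decomposition (map (λ v → node v []) (allFin n))
      (↭-reflexive (vertices-singletons (allFin n))) (↭-reflexive (edges-singletons (allFin n)))
      (All.tabulate singleton-bounded)
      where
      vertices-singletons : ∀ vs → concatMap vertices (map (λ v → node v []) vs) ≡ vs
      vertices-singletons [] = refl
      vertices-singletons (v ∷ vs) = cong (v ∷_) (vertices-singletons vs)
      edges-singletons : ∀ vs → concatMap edges (map (λ v → node v []) vs) ≡ []
      edges-singletons [] = refl
      edges-singletons (v ∷ vs) = edges-singletons vs
      singleton-bounded : ∀ {t} → t ∈ map (λ v → node v []) (allFin n) → DegreeBounded (degree []) 0 t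
      singleton-bounded t∈ with ∈-map⁻ (λ v → node v []) t∈
      ... | _ , _ , refl = node z≤n []

    attach-leaf : ∀ {F F′ : List (Edge n)} {p ℓ} b → F ↭ link b p ℓ ∷ F′ → p ≢ ℓ → degree F′ ℓ ≡ 0 →
                  RootedDecomposition F′ → RootedDecomposition F
    attach-leaf {F} {F′} {p} {ℓ} b F↭ p≢ℓ isolated-ℓ (decomposition Ts spans covers bounded)
      with Ts₀ , Ts↭ ← isolated⇒singleton Ts (∈-resp-↭ (↭-sym spans) (∈-allFin ℓ))
                         (degree≡0⇒isolated (trans (degree-↭ ℓ covers) isolated-ℓ))
      with Ts′ , vs , es , bounded′ ←
             Graft.graft-forest (degree F′) (degree F) (degree-↭∷-mono F↭) b p ℓ
               (≤-reflexive (sym (degree-↭∷-incident F↭ (link-incidentˡ b))))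
               (≤-trans (s≤s z≤n) (≤-reflexive (sym (degree-↭∷-incident F↭ (link-incidentʳ b)))))
               Ts₀ (∈-∷⁻ (∈-resp-↭ (concatMap-↭ vertices Ts↭) (∈-resp-↭ (↭-sym spans) (∈-allFin p))) p≢ℓ)
               (All.tail (All-resp-↭ Ts↭ bounded))
      = decomposition Ts′
          (↭-trans vs (↭-trans (↭-sym (concatMap-↭ vertices Ts↭)) spans))
          (↭-trans es (↭-trans (↭-prep _ (↭-trans (↭-sym (concatMap-↭ edges Ts↭)) covers)) (↭-sym F↭)))
          bounded′

    decompose-by-length : ∀ m (F : List (Edge n)) → length F ≡ m → IsForest F → RootedDecomposition F
    decompose-by-length _ [] _ _ = singletons
    decompose-by-length (suc m) (f ∷ F) len forest
      with ℓ , deg-ℓ ← forest⇒leaf (f ∷ F) forest (here refl)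
      with e , F′ , F↭ , ℓ∈e , isolated-ℓ ← extract-incident (f ∷ F) deg-ℓ
      with p , b , refl ← incident⇒link e ℓ∈e
      = attach-leaf b F↭ (link∈⇒endpoints-distinct b (proj₁ forest) (∈-resp-↭ (↭-sym F↭) (here refl))) isolated-ℓ
          (decompose-by-length m F′ (suc-injective (trans (sym (↭-length F↭)) len))
                               (IsForest-∷⁻ (IsForest-resp-↭ F↭ forest)))

    decompose : (F : List (Edge n)) → IsForest F → RootedDecomposition F
    decompose F = decompose-by-length (length F) F refl

  -- Greedy clustering

  module _ {n : ℕ} where

    Within : List (Fin n) → Edge n → Set
    Within X (a , b) = a ∈ X × b ∈ X

    Inside : List (List (Fin n)) → Edge n → Set
    Inside Cls e = ∃ λ C → C ∈ Cls × Within C e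

    Within-mono : ∀ {X Y} → X ⊆ Y → ∀ {e} → Within X e → Within Y e
    Within-mono X⊆Y (a∈ , b∈) = X⊆Y a∈ , X⊆Y b∈

    Inside-mono : ∀ {Cls Cls′} → Cls ⊆ Cls′ → ∀ {e} → Inside Cls e → Inside Cls′ e
    Inside-mono Cls⊆ (C , C∈ , within) = C , Cls⊆ C∈ , within

    link-within : ∀ b {X v c} → v ∈ X → c ∈ X → Within X (link b v c)
    link-within false v∈ c∈ = v∈ , c∈
    link-within true v∈ c∈ = c∈ , v∈

    record IsClusteringOf (k : ℕ) (V : List (Fin n)) (E : List (Edge n))
                          (Cls : List (List (Fin n))) (S K : List (Edge n)) : Set where
      constructor is-clustering
      field
        partition   : concat Cls ↭ V
        split       : S ++ K ↭ E
        small       : All (λ C → length C ≤ k) Cls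
        kept-inside : All (Inside Cls) K

    IsClusteringOf-++ : ∀ {k V V′ E E′ Cls Cls′ S S′ K K′} →
      IsClusteringOf k V E Cls S K → IsClusteringOf k V′ E′ Cls′ S′ K′ →
      IsClusteringOf k (V ++ V′) (E ++ E′) (Cls ++ Cls′) (S ++ S′) (K ++ K′)
    IsClusteringOf-++ {Cls = Cls} {Cls′} {S} {S′} {K} {K′}
                      (is-clustering p s sm ins) (is-clustering p′ s′ sm′ ins′) =
      is-clustering (↭-trans (↭-reflexive (sym (concat-++ Cls Cls′))) (↭-++⁺ p p′))
                    (↭-trans (++-interchange S S′ K K′) (↭-++⁺ s s′))
                    (Allₚ.++⁺ sm sm′)
                    (Allₚ.++⁺ (All.map (Inside-mono (xs⊆xs++ys Cls Cls′)) ins)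
                              (All.map (Inside-mono (xs⊆ys++xs Cls′ Cls)) ins′))

  m≤1⇒m*n≤n : ∀ {h} x → h ≤ 1 → h * x ≤ x
  m≤1⇒m*n≤n x h≤1 = ≤-trans (*-monoˡ-≤ x h≤1) (≤-reflexive (*-identityˡ x))

  merge-potential : ∀ {h} X d A V → h ≤ 1 → X + d * A ≤ d * V → X + h * (d * suc A) ≤ d * suc V
  merge-potential {h} X d A V h≤1 pot = begin
    X + h * (d * suc A) ≤⟨ +-monoʳ-≤ X (m≤1⇒m*n≤n (d * suc A) h≤1) ⟩
    X + d * suc A       ≡⟨ rearrange X d A ⟩
    d + (X + d * A)     ≤⟨ +-monoʳ-≤ d pot ⟩
    d + d * V           ≡⟨ *-suc d V ⟨
    d * suc V           ∎
    where
    open ≤-Reasoning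
    rearrange : ∀ X d A → X + d * suc A ≡ d + (X + d * A)
    rearrange = solve-∀

  children-cost : ∀ {h} c k d A → c + h ≤ d → h ≤ 1 → c ≤ A → k ≤ A → c * suc k + h * d ≤ d + d * A
  children-cost c k d A c≤d z≤n c≤A k≤A = begin
    c * suc k + 0 * d ≡⟨ +-identityʳ (c * suc k) ⟩
    c * suc k         ≤⟨ *-mono-≤ (≤-trans (≤-reflexive (sym (+-identityʳ c))) c≤d) (s≤s k≤A) ⟩
    d * suc A         ≡⟨ *-suc d A ⟩
    d + d * A         ∎
    where open ≤-Reasoning
  children-cost c k d A c+1≤d (s≤s z≤n) c≤A k≤A = begin
    c * suc k + 1 * d ≡⟨ cong (c * suc k +_) (*-identityˡ d) ⟩
    c * suc k + d     ≡⟨ +-comm (c * suc k) d ⟩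
    d + c * suc k     ≡⟨ cong (d +_) (*-suc c k) ⟩
    d + (c + c * k)   ≤⟨ +-monoʳ-≤ d (+-mono-≤ c≤A (*-monoʳ-≤ c k≤A)) ⟩
    d + suc c * A     ≤⟨ +-monoʳ-≤ d (*-monoˡ-≤ A (≤-trans (≤-reflexive (+-comm 1 c)) c+1≤d)) ⟩
    d + d * A         ∎
    where open ≤-Reasoning

  close-potential : ∀ {h} c S k d A V → c + h ≤ d → h ≤ 1 → c ≤ A → k ≤ A →
                    S * suc k + d * A ≤ d * V → (c + S) * suc k + h * (d * 1) ≤ d * suc V
  close-potential {h} c S k d A V c+h≤d h≤1 c≤A k≤A pot = begin
    (c + S) * suc k + h * (d * 1)     ≡⟨ rearrange c S k d h ⟩
    (c * suc k + h * d) + S * suc k   ≤⟨ +-monoˡ-≤ (S * suc k) (children-cost c k d A c+h≤d h≤1 c≤A k≤A) ⟩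
    (d + d * A) + S * suc k           ≡⟨ +-assoc d (d * A) (S * suc k) ⟩
    d + (d * A + S * suc k)           ≤⟨ +-monoʳ-≤ d (≤-trans (≤-reflexive (+-comm (d * A) (S * suc k))) pot) ⟩
    d + d * V                         ≡⟨ *-suc d V ⟨
    d * suc V                         ∎
    where
    open ≤-Reasoning
    rearrange : ∀ c S k d h → (c + S) * suc k + h * (d * 1) ≡ (c * suc k + h * d) + S * suc k
    rearrange = solve-∀

  potential-+ : ∀ a b x y V W K d → a * K + 1 * (d * x) ≤ d * V → b * K + d * y ≤ d * W →
                (a + b) * K + d * (x + y) ≤ d * (V + W)
  potential-+ a b x y V W K d pot₁ pot₂ = begin
    (a + b) * K + d * (x + y)                 ≡⟨ rearrange a b x y K d ⟩
    (a * K + 1 * (d * x)) + (b * K + d * y)   ≤⟨ +-mono-≤ pot₁ pot₂ ⟩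
    d * V + d * W                             ≡⟨ *-distribˡ-+ d V W ⟨
    d * (V + W)                               ∎
    where
    open ≤-Reasoning
    rearrange : ∀ a b x y K d → (a + b) * K + d * (x + y) ≡ (a * K + 1 * (d * x)) + (b * K + d * y)
    rearrange = solve-∀

  module Greedy {n : ℕ} (k : ℕ) where

    record Clustering : Set where
      constructor clustering
      field
        active : List (Fin n)
        closed : List (List (Fin n))
        cut    : List (Edge n)
        kept   : List (Edge n)

    record BranchClustering : Set where
      constructor branch-clustering
      field
        actives : List (List (Fin n))
        closed* : List (List (Fin n))
        cut*    : List (Edge n)
        kept*   : List (Edge n)
        links   : List (Edge n)

    open Clustering public
    open BranchClustering public

    add-branch : Edge n → Clustering → BranchClustering → BranchClustering
    add-branch e (clustering A C S K) (branch-clustering As Cs Ss Ks Ls) =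
      branch-clustering (A ∷ As) (C ++ Cs) (S ++ Ss) (K ++ Ks) (e ∷ Ls)

    close-or-merge : Fin n → BranchClustering → Clustering
    close-or-merge v (branch-clustering As Cs Ss Ks Ls) with suc (length (concat As)) ≤? k
    ... | yes _ = clustering (v ∷ concat As) Cs Ss (Ls ++ Ks)
    ... | no _ = clustering [ v ] (As ++ Cs) (Ls ++ Ss) Ks

    mutual
      cluster : Tree n → Clustering
      cluster (node v bs) = close-or-merge v (cluster* v bs)

      cluster* : Fin n → Branches n → BranchClustering
      cluster* v [] = branch-clustering [] [] [] [] []
      cluster* v ((b , t) ∷ bs) = add-branch (link b v (root t)) (cluster t) (cluster* v bs)

    record IsTreeClustering (t : Tree n) (r : Clustering) : Set where
      field
        clusters        : IsClusteringOf k (vertices t) (edges t) (active r ∷ closed r) (cut r) (kept r)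
        active-nonempty : 1 ≤ length (active r)
        root-active     : root t ∈ active r

    record IsBranchClustering (v : Fin n) (bs : Branches n) (r : BranchClustering) : Set where
      field
        partition        : concat (actives r) ++ concat (closed* r) ↭ vertices* bs
        split            : links r ++ cut* r ++ kept* r ↭ edges* v bs
        actives-nonempty : All (λ C → 1 ≤ length C) (actives r)
        small            : All (λ C → length C ≤ k) (actives r ++ closed* r)
        kept-inside      : All (Inside (actives r ++ closed* r)) (kept* r)
        links-within     : All (Within (v ∷ concat (actives r))) (links r)
        links-count      : length (links r) ≡ length bs
        actives-count    : length (actives r) ≡ length bs

    Inside-merge : ∀ {v} {As Cs : List (List (Fin n))} {e} →
                   Inside (As ++ Cs) e → Inside ((v ∷ concat As) ∷ Cs) e
    Inside-merge {As = As} (C , C∈ , within) with ∈-++⁻ As C∈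
    ... | inj₁ C∈As = _ , here refl , Within-mono (λ x∈C → there (∈-concat⁺′ x∈C C∈As)) within
    ... | inj₂ C∈Cs = C , there C∈Cs , within

    add-branch-invariant : ∀ {b v t bs rt rb} → IsTreeClustering t rt → IsBranchClustering v bs rb →
      IsBranchClustering v ((b , t) ∷ bs) (add-branch (link b v (root t)) rt rb)
    add-branch-invariant {b} {v} {t} {bs} {clustering A C S K} {branch-clustering As Cs Ss Ks Ls} T B = record
      { partition = begin
          (A ++ concat As) ++ concat (C ++ Cs)        ≡⟨ cong ((A ++ concat As) ++_) (concat-++ C Cs) ⟨
          (A ++ concat As) ++ (concat C ++ concat Cs) ↭⟨ ++-interchange A (concat As) (concat C) (concat Cs) ⟩
          (A ++ concat C) ++ (concat As ++ concat Cs) ↭⟨ ↭-++⁺ TC.partition B.partition ⟩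
          vertices t ++ vertices* bs                  ∎
      ; split = ↭-prep _ (begin
          Ls ++ (S ++ Ss) ++ (K ++ Ks) ↭⟨ ++⁺ˡ Ls (++-interchange S Ss K Ks) ⟩
          Ls ++ (S ++ K) ++ (Ss ++ Ks) ↭⟨ shifts Ls (S ++ K) ⟩
          (S ++ K) ++ Ls ++ Ss ++ Ks   ↭⟨ ↭-++⁺ TC.split B.split ⟩
          edges t ++ edges* v bs       ∎)
      ; actives-nonempty = T.active-nonempty ∷ B.actives-nonempty
      ; small = All-resp-↭ (↭-sym clusters↭) (Allₚ.++⁺ TC.small B.small)
      ; kept-inside = Allₚ.++⁺ (All.map (Inside-mono tree⊆clusters) TC.kept-inside)
                               (All.map (Inside-mono branches⊆clusters) B.kept-inside)
      ; links-within = link-within b (here refl) (there (∈-++⁺ˡ T.root-active))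
                       ∷ All.map (Within-mono (∷⁺ʳ v (xs⊆ys++xs (concat As) A))) B.links-within
      ; links-count = cong suc B.links-count
      ; actives-count = cong suc B.actives-count
      }
      where
      open PermutationReasoning
      module T = IsTreeClustering T
      module TC = IsClusteringOf T.clusters
      module B = IsBranchClustering B
      clusters↭ : (A ∷ As) ++ (C ++ Cs) ↭ (A ∷ C) ++ (As ++ Cs)
      clusters↭ = ++-interchange [ A ] As C Cs
      tree⊆clusters : A ∷ C ⊆ (A ∷ As) ++ (C ++ Cs)
      tree⊆clusters = ⊆-trans (xs⊆xs++ys (A ∷ C) (As ++ Cs)) (⊆-reflexive-↭ (↭-sym clusters↭))
      branches⊆clusters : As ++ Cs ⊆ (A ∷ As) ++ (C ++ Cs)
      branches⊆clusters = ⊆-trans (xs⊆ys++xs (As ++ Cs) (A ∷ C)) (⊆-reflexive-↭ (↭-sym clusters↭))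

    close-or-merge-invariant : ∀ {v bs rb} → 1 ≤ k → IsBranchClustering v bs rb →
                               IsTreeClustering (node v bs) (close-or-merge v rb)
    close-or-merge-invariant {v} {bs} {branch-clustering As Cs Ss Ks Ls} k≥1 B
      with suc (length (concat As)) ≤? k
    ... | yes fits = record
      { clusters = is-clustering (↭-prep v B.partition)
                                 (↭-trans (shifts Ss Ls) B.split)
                                 (fits ∷ Allₚ.++⁻ʳ As B.small)
                                 (Allₚ.++⁺ (All.map (λ w → _ , here refl , w) B.links-within)
                                           (All.map Inside-merge B.kept-inside))
      ; active-nonempty = s≤s z≤n
      ; root-active = here refl
      }
      where module B = IsBranchClustering B
    ... | no _ = record
      { clusters = is-clustering (↭-prep v (↭-trans (↭-reflexive (sym (concat-++ As Cs))) B.partition))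
                                 (↭-trans (↭-reflexive (++-assoc Ls Ss Ks)) B.split)
                                 (k≥1 ∷ B.small)
                                 (All.map (Inside-mono (xs⊆x∷xs _ [ v ])) B.kept-inside)
      ; active-nonempty = s≤s z≤n
      ; root-active = here refl
      }
      where module B = IsBranchClustering B

    mutual
      cluster-invariant : 1 ≤ k → ∀ t → IsTreeClustering t (cluster t)
      cluster-invariant k≥1 (node v bs) = close-or-merge-invariant k≥1 (cluster*-invariant k≥1 v bs)

      cluster*-invariant : 1 ≤ k → ∀ v bs → IsBranchClustering v bs (cluster* v bs)
      cluster*-invariant k≥1 v [] = record
        { partition = ↭-refl ; split = ↭-refl ; actives-nonempty = [] ; small = [] ; kept-inside = []
        ; links-within = [] ; links-count = refl ; actives-count = refl }
      cluster*-invariant k≥1 v ((b , t) ∷ bs) =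
        add-branch-invariant (cluster-invariant k≥1 t) (cluster*-invariant k≥1 v bs)

    clusters : List (Tree n) → List (List (Fin n))
    clusters = concatMap λ t → active (cluster t) ∷ closed (cluster t)

    cuts : List (Tree n) → List (Edge n)
    cuts = concatMap (cut ∘ cluster)

    keeps : List (Tree n) → List (Edge n)
    keeps = concatMap (kept ∘ cluster)

    clusters-invariant : 1 ≤ k → ∀ Ts →
      IsClusteringOf k (concatMap vertices Ts) (concatMap edges Ts) (clusters Ts) (cuts Ts) (keeps Ts)
    clusters-invariant k≥1 [] = is-clustering ↭-refl ↭-refl [] []
    clusters-invariant k≥1 (t ∷ Ts) =
      IsClusteringOf-++ (IsTreeClustering.clusters (cluster-invariant k≥1 t)) (clusters-invariant k≥1 Ts)

    module _ (k≥1 : 1 ≤ k) (d : ℕ) where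

      Bounded : ℕ → Tree n → Set
      Bounded = DegreeBounded (λ _ → d)

      close-or-merge-bound : ∀ {h v bs rb} → IsBranchClustering v bs rb → h ≤ 1 → length bs + h ≤ d →
        length (cut* rb) * suc k + d * length (concat (actives rb)) ≤ d * length (vertices* bs) →
        length (cut (close-or-merge v rb)) * suc k + h * (d * length (active (close-or-merge v rb)))
          ≤ d * suc (length (vertices* bs))
      close-or-merge-bound {h} {v} {bs} {branch-clustering As Cs Ss Ks Ls} B h≤1 deg pot
        with suc (length (concat As)) ≤? k
      ... | yes _ = merge-potential (length Ss * suc k) d (length (concat As)) (length (vertices* bs)) h≤1 pot
      ... | no too-big =
        subst (λ c → c * suc k + h * (d * 1) ≤ d * suc (length (vertices* bs)))
              (sym (trans (length-++ Ls) (cong (_+ length Ss) B.links-count)))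
              (close-potential (length bs) (length Ss) k d (length (concat As)) (length (vertices* bs))
                               deg h≤1 children≤size (≤-pred (≰⇒> too-big)) pot)
        where
        module B = IsBranchClustering B
        children≤size : length bs ≤ length (concat As)
        children≤size =
          subst (_≤ length (concat As)) B.actives-count (length≤length-concat As B.actives-nonempty)

      mutual
        cluster-bound : ∀ {h} t → h ≤ 1 → Bounded h t →
          length (cut (cluster t)) * suc k + h * (d * length (active (cluster t))) ≤ d * length (vertices t)
        cluster-bound (node v bs) h≤1 (node deg bs-bounded) =
          close-or-merge-bound (cluster*-invariant k≥1 v bs) h≤1 deg (cluster*-bound v bs bs-bounded)

        cluster*-bound : ∀ v bs → DegreeBounded* (λ _ → d) bs →
          length (cut* (cluster* v bs)) * suc k + d * length (concat (actives (cluster* v bs)))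
            ≤ d * length (vertices* bs)
        cluster*-bound v [] [] = ≤-refl
        cluster*-bound v ((b , t) ∷ bs) (t-bounded ∷ bs-bounded) = begin
          length (cut r ++ cut* rs) * suc k + d * length (active r ++ concat (actives rs))
            ≡⟨ cong₂ (λ c a → c * suc k + d * a) (length-++ (cut r)) (length-++ (active r)) ⟩
          (length (cut r) + length (cut* rs)) * suc k + d * (length (active r) + length (concat (actives rs)))
            ≤⟨ potential-+ (length (cut r)) (length (cut* rs)) (length (active r)) (length (concat (actives rs)))
                           (length (vertices t)) (length (vertices* bs)) (suc k) d
                           (cluster-bound t (s≤s z≤n) t-bounded) (cluster*-bound v bs bs-bounded) ⟩
          d * (length (vertices t) + length (vertices* bs))
            ≡⟨ cong (d *_) (length-++ (vertices t)) ⟨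
          d * length (vertices t ++ vertices* bs)
            ∎
          where
          open ≤-Reasoning
          r = cluster t
          rs = cluster* v bs

      cuts-bound : ∀ Ts → All (Bounded 0) Ts → length (cuts Ts) * suc k ≤ d * length (concatMap vertices Ts)
      cuts-bound [] [] = z≤n
      cuts-bound (t ∷ Ts) (t-bounded ∷ Ts-bounded) = begin
        length (cut r ++ cuts Ts) * suc k
          ≡⟨ cong (_* suc k) (length-++ (cut r)) ⟩
        (length (cut r) + length (cuts Ts)) * suc k
          ≡⟨ *-distribʳ-+ (suc k) (length (cut r)) (length (cuts Ts)) ⟩
        length (cut r) * suc k + length (cuts Ts) * suc k
          ≤⟨ +-mono-≤ (≤-trans (m≤m+n _ 0) (cluster-bound t z≤n t-bounded)) (cuts-bound Ts Ts-bounded) ⟩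
        d * length (vertices t) + d * length (concatMap vertices Ts)
          ≡⟨ *-distribˡ-+ d (length (vertices t)) _ ⟨
        d * (length (vertices t) + length (concatMap vertices Ts))
          ≡⟨ cong (d *_) (length-++ (vertices t)) ⟨
        d * length (vertices t ++ concatMap vertices Ts)
          ∎
        where
        open ≤-Reasoning
        r = cluster t

  module _ {n : ℕ} where

    reachable-within-cluster : ∀ {Cls : List (List (Fin n))} {K} → Unique (concat Cls) → All (Inside Cls) K →
      ∀ {u w} → Reachable K u w → ∀ {C} → C ∈ Cls → u ∈ C → w ∈ C
    reachable-within-cluster uniq inside ε C∈ u∈C = u∈C
    reachable-within-cluster {Cls} uniq inside (inj₁ ux∈K ◅ path) C∈ u∈C with All.lookup inside ux∈K
    ... | C′ , C′∈ , u∈C′ , x∈C′ =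
      reachable-within-cluster uniq inside path C∈
        (subst (_ ∈_) (Unique-concat-overlap⇒≡ Cls uniq C′∈ C∈ u∈C′ u∈C) x∈C′)
    reachable-within-cluster {Cls} uniq inside (inj₂ xu∈K ◅ path) C∈ u∈C with All.lookup inside xu∈K
    ... | C′ , C′∈ , x∈C′ , u∈C′ =
      reachable-within-cluster uniq inside path C∈
        (subst (_ ∈_) (Unique-concat-overlap⇒≡ Cls uniq C′∈ C∈ u∈C′ u∈C) x∈C′)

    clustering⇒components-small : ∀ {k E Cls S K} → IsClusteringOf k (allFin n) E Cls S K →
      ∀ v us → Unique us → All (Reachable K v) us → length us ≤ k
    clustering⇒components-small {k} {Cls = Cls} (is-clustering partition _ small inside) v us uniq reachable
      with C , v∈C , C∈ ← ∈-concat⁻′ Cls (∈-resp-↭ (↭-sym partition) (∈-allFin v)) = begin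
        length us ≤⟨ Unique⇒length≤ uniq (All.map (λ v~u → reachable-within-cluster uniq-Cls inside v~u C∈ v∈C)
                                                   reachable) ⟩
        length C  ≤⟨ All.lookup small C∈ ⟩
        k         ∎
      where
      open ≤-Reasoning
      uniq-Cls : Unique (concat Cls)
      uniq-Cls = Unique-resp-↭ (↭-sym partition) (allFin⁺ n)

    IsClusteringOf-resp-↭ : ∀ {k V V′ E E′ Cls S K} → V ↭ V′ → E ↭ E′ →
      IsClusteringOf {n} k V E Cls S K → IsClusteringOf k V′ E′ Cls S K
    IsClusteringOf-resp-↭ V↭ E↭ (is-clustering partition split small inside) =
      is-clustering (↭-trans partition V↭) (↭-trans split E↭) small inside

    forest-clustering : ∀ k → 1 ≤ k → ∀ d (F : List (Edge n)) → IsForest F → (∀ v → degree F v ≤ d) →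
      ∃ λ S → ∃ λ R → (F ↭ S ++ R) × (length S * suc k ≤ d * n) ×
        (∀ v us → Unique us → All (Reachable R v) us → length us ≤ k)
    forest-clustering k k≥1 d F forest deg =
      cuts trees , keeps trees , ↭-sym (IsClusteringOf.split clustered) , cost ,
      clustering⇒components-small clustered
      where
      open RootedDecomposition (decompose F forest)
      open Greedy k
      clustered : IsClusteringOf k (allFin n) F (clusters trees) (cuts trees) (keeps trees)
      clustered = IsClusteringOf-resp-↭ spans covers (clusters-invariant k≥1 trees)
      cost : length (cuts trees) * suc k ≤ d * n
      cost = subst (λ m → length (cuts trees) * suc k ≤ d * m)
                   (trans (↭-length spans) (length-tabulate (λ i → i)))
                   (cuts-bound k≥1 d trees (All.map (DegreeBounded-mono deg) bounded))

  -- Rescaling by ρ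

  mkℚᵘ-mono-≤ : ∀ p q r s → p * suc s ≤ r * suc q → mkℚᵘ (ℤ.+ p) q ℚᵘ.≤ mkℚᵘ (ℤ.+ r) s
  mkℚᵘ-mono-≤ p q r s le = *≤* (subst₂ ℤ._≤_ (ℤ.pos-* p (suc s)) (ℤ.pos-* r (suc q)) (+≤+ le))

  mkℚᵘ-mono-< : ∀ p q r s → p * suc s < r * suc q → mkℚᵘ (ℤ.+ p) q ℚᵘ.< mkℚᵘ (ℤ.+ r) s
  mkℚᵘ-mono-< p q r s lt = *<* (subst₂ ℤ._<_ (ℤ.pos-* p (suc s)) (ℤ.pos-* r (suc q)) (+<+ lt))

  mkℚᵘ-cancel-≤ : ∀ p q r s → mkℚᵘ (ℤ.+ p) q ℚᵘ.≤ mkℚᵘ (ℤ.+ r) s → p * suc s ≤ r * suc q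
  mkℚᵘ-cancel-≤ p q r s (*≤* le) =
    ℤ.drop‿+≤+ (subst₂ ℤ._≤_ (sym (ℤ.pos-* p (suc s))) (sym (ℤ.pos-* r (suc q))) le)

  toℚᵘ-toℚ : ∀ x → toℚᵘ (toℚ x) ℚᵘ.≃ mkℚᵘ (ℤ.+ x) 0
  toℚᵘ-toℚ x = ℚ.toℚᵘ-fromℚᵘ (mkℚᵘ (ℤ.+ x) 0)

  toℚᵘ-1/n : ∀ n′ → toℚᵘ ((ℤ.+ 1) /ℚ suc n′) ℚᵘ.≃ mkℚᵘ (ℤ.+ 1) n′
  toℚᵘ-1/n n′ = ℚ.toℚᵘ-fromℚᵘ (mkℚᵘ (ℤ.+ 1) n′)

  1/n≤ρ⇒ρ≥0 : ∀ {n′ m b′} .{c : Coprime (suc m) (suc b′)} → ¬ ((ℤ.+ 1) /ℚ suc n′ ℚ.≤ mkℚ -[1+ m ] b′ c)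
  1/n≤ρ⇒ρ≥0 {n′} 1/n≤ρ with ℚᵘ.≤-respˡ-≃ (toℚᵘ-1/n n′) (ℚ.toℚᵘ-mono-≤ 1/n≤ρ)
  ... | *≤* ()

  cut-count-bound : ∀ s a d n b k → s * suc k ≤ d * n → a * n < suc k * b → 1 ≤ d → 1 ≤ b → s * a < d * b
  cut-count-bound zero a (suc d) n (suc b) k _ _ _ _ = s≤s z≤n
  cut-count-bound (suc s) a d n b k cost an<[k+1]b _ _ = *-cancelʳ-< n (suc s * a) (d * b) (begin-strict
    suc s * a * n       ≡⟨ *-assoc (suc s) a n ⟩
    suc s * (a * n)     <⟨ *-monoʳ-< (suc s) an<[k+1]b ⟩
    suc s * (suc k * b) ≡⟨ *-assoc (suc s) (suc k) b ⟨
    suc s * suc k * b   ≤⟨ *-monoˡ-≤ b cost ⟩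
    d * n * b           ≡⟨ rearrange d n b ⟩
    d * b * n           ∎)
    where
    open ≤-Reasoning
    rearrange : ∀ d n b → d * n * b ≡ d * b * n
    rearrange = solve-∀

  division-bounds : ∀ m b .{{_ : NonZero b}} → b ≤ m → ∃ λ k → 1 ≤ k × k * b ≤ m × m < suc k * b
  division-bounds m b b≤m =
    m / b , m≥n⇒m/n>0 b≤m , m/n*n≤m m b ,
    subst (_< suc (m / b) * b) (sym (m≡m%n+[m/n]*n m b)) (+-monoˡ-< (m / b * b) (m%n<n m b))

  module _ (a b′ : ℕ) .(coprime : Coprime a (suc b′)) where

    private
      ρ : ℚ
      ρ = mkℚ (ℤ.+ a) b′ coprime

    1/n≤ρ⇒b≤a*n : ∀ n′ → (ℤ.+ 1) /ℚ suc n′ ℚ.≤ ρ → suc b′ ≤ a * suc n′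
    1/n≤ρ⇒b≤a*n n′ 1/n≤ρ = subst (_≤ a * suc n′) (*-identityˡ (suc b′))
      (mkℚᵘ-cancel-≤ 1 n′ a b′ (ℚᵘ.≤-respˡ-≃ (toℚᵘ-1/n n′) (ℚ.toℚᵘ-mono-≤ 1/n≤ρ)))

    toℚ≤ρ*toℚ : ∀ x m → x * suc b′ ≤ a * m → toℚ x ℚ.≤ ρ ℚ.* toℚ m
    toℚ≤ρ*toℚ x m le = ℚ.toℚᵘ-cancel-≤
      (ℚᵘ.≤-respʳ-≃ (ℚᵘ.≃-sym ρ*m≃) (ℚᵘ.≤-respˡ-≃ (ℚᵘ.≃-sym (toℚᵘ-toℚ x))
        (mkℚᵘ-mono-≤ x 0 (a * m) b′ (subst (x * suc b′ ≤_) (sym (*-identityʳ (a * m))) le))))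
      where
      ρ*m≃ : toℚᵘ (ρ ℚ.* toℚ m) ℚᵘ.≃ mkℚᵘ (ℤ.+ (a * m)) b′
      ρ*m≃ = ℚᵘ.≃-trans (ℚ.toℚᵘ-homo-* ρ (toℚ m))
               (ℚᵘ.≃-trans (ℚᵘ.*-congˡ {toℚᵘ ρ} (toℚᵘ-toℚ m))
                 (ℚᵘ.≃-reflexive (cong₂ mkℚᵘ (sym (ℤ.pos-* a m)) (*-identityʳ b′))))

    toℚ*ρ<toℚ : ∀ s d → s * a < d * suc b′ → toℚ s ℚ.* ρ ℚ.< toℚ d
    toℚ*ρ<toℚ s d lt = ℚ.toℚᵘ-cancel-<
      (ℚᵘ.<-respʳ-≃ (ℚᵘ.≃-sym (toℚᵘ-toℚ d)) (ℚᵘ.<-respˡ-≃ (ℚᵘ.≃-sym s*ρ≃)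
        (mkℚᵘ-mono-< (s * a) b′ d 0 (subst (_< d * suc b′) (sym (*-identityʳ (s * a))) lt))))
      where
      s*ρ≃ : toℚᵘ (toℚ s ℚ.* ρ) ℚᵘ.≃ mkℚᵘ (ℤ.+ (s * a)) b′
      s*ρ≃ = ℚᵘ.≃-trans (ℚ.toℚᵘ-homo-* (toℚ s) ρ)
               (ℚᵘ.≃-trans (ℚᵘ.*-congʳ {toℚᵘ ρ} (toℚᵘ-toℚ s))
                 (ℚᵘ.≃-reflexive (cong₂ mkℚᵘ (sym (ℤ.pos-* s a)) (+-identityʳ b′))))

    cuts*ρ<d : ∀ s {k d n} → s * suc k ≤ d * n → a * n < suc k * suc b′ → 1 ≤ d → toℚ s ℚ.* ρ ℚ.< toℚ d
    cuts*ρ<d s {k} {d} {n} cost an<[k+1]b d≥1 =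
      toℚ*ρ<toℚ s d (cut-count-bound s a d n (suc b′) k cost an<[k+1]b d≥1 (s≤s z≤n))

    size≤ρ*n : ∀ n {x k} → x ≤ k → k * suc b′ ≤ a * n → toℚ x ℚ.≤ ρ ℚ.* toℚ n
    size≤ρ*n n {x} x≤k kb≤an = toℚ≤ρ*toℚ x n (≤-trans (*-monoˡ-≤ (suc b′) x≤k) kb≤an)

open ForestClustering
  using (forest-clustering; division-bounds; 1/n≤ρ⇒ρ≥0; 1/n≤ρ⇒b≤a*n; cuts*ρ<d; size≤ρ*n)
open import Data.Nat using (ℕ; suc; NonZero; _≤_)
open import Data.Fin using (Fin)
open import Data.Integer using (+_; -[1+_])
open import Data.Rational using (ℚ; mkℚ; _/_; _*_; _<_)
open import Data.Product using (Σ; _×_; _,_)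
open import Data.Empty using (⊥-elim)
open import Data.List using (List; _++_; length)
open import Data.List.Relation.Binary.Permutation.Propositional using (_↭_)

lemma3p2 : ∀ (n d : ℕ) .{{_ : NonZero n}} → 1 ≤ d → (F : List (Edge n)) → IsForest F →
           (∀ (v : Fin n) → degree F v ≤ d) → (ρ : ℚ) → Data.Rational._≤_ ((+ 1) / n) ρ →
           Σ (List (Edge n)) λ S → Σ (List (Edge n)) λ R →
             (F ↭ S ++ R) × (toℚ (length S) * ρ < toℚ d) × ComponentsAtMost R (ρ * toℚ n)
lemma3p2 (suc n′) d d≥1 F forest deg (mkℚ -[1+ _ ] _ _) 1/n≤ρ = ⊥-elim (1/n≤ρ⇒ρ≥0 {n′} 1/n≤ρ)
lemma3p2 n@(suc n′) d d≥1 F forest deg (mkℚ (+ a) b′ coprime) 1/n≤ρ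
  with k , k≥1 , kb≤an , an<[k+1]b ← division-bounds _ _ (1/n≤ρ⇒b≤a*n a b′ coprime n′ 1/n≤ρ)
  with S , R , F↭ , cost , small ← forest-clustering k k≥1 d F forest deg
  = S , R , F↭ , cuts*ρ<d a b′ coprime (length S) cost an<[k+1]b d≥1 ,
    λ v us uniq reachable → size≤ρ*n a b′ coprime n (small v us uniq reachable) kb≤an
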